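{- Let $T$ be a $7$-tournament with vertices $v_1,\dots,v_7$ such that $T[v_1,\dots,v_6]$ is isomorphic to $L_6$. If $v_i$ ($i\le 6$) and $v_7$ are covertices or revertices in $T$, then for every $j\in\{1,\dots,6\}\setminus\{i\}$, $v_j$ and $v_7$ are neither covertices nor revertices in $T$.
   Context: A tournament is a directed graph with exactly one arc between each pair of distinct vertices; $u\rightarrow v$ means the arc goes from $u$ to $v$; $T[X]$ is the subtournament induced by $X$. $L_6$ is the tournament on $u_1,\dots,u_6$ with $u_a\rightarrow u_b$ for $1\le a<b\le 5$, $u_6\rightarrow u_1,u_3,u_5$ and $u_2,u_4\rightarrow u_6$. Distinct vertices $a,b$ of $T$ are covertices if for every $v\in V(T)\setminus\{a,b\}$, $a\rightarrow v$ iff $b\rightarrow v$; they are revertices if for every $v\in V(T)\setminus\{a,b\}$, $a\rightarrow v$ iff $v\rightarrow b$. -}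

module Defs where

open import Data.Nat using (ℕ; _<_)
open import Data.Fin using (Fin; toℕ; inject₁; fromℕ)
open import Data.Product using (_×_; Σ)
open import Data.Sum using (_⊎_)
open import Data.Empty using (⊥)
open import Relation.Nullary using (¬_)
open import Relation.Binary.PropositionalEquality using (_≡_)
open import Function.Bundles using (_↔_; _⇔_; Inverse)
open import Level using (0ℓ)

record Tournament (n : ℕ) : Set₁ where
  field
    _⇒_      : Fin n → Fin n → Set
    irrefl   : ∀ u → ¬ (u ⇒ u)
    total    : ∀ u v → ¬ (u ≡ v) → (u ⇒ v) ⊎ (v ⇒ u)
    antisym  : ∀ u v → u ⇒ v → v ⇒ u → ⊥

open Tournament public

-- L6 on vertices u1..u6, represented as Fin 6 with u_k = index k-1.
-- Arcs: u_a → u_b for 1 ≤ a < b ≤ 5; u6 → u1,u3,u5; u2,u4 → u6.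
-- In 0-based indices: a → b for a < b ≤ 4; 5 → 0,2,4; 1,3 → 5.
data L6-arc : Fin 6 → Fin 6 → Set where
  low  : ∀ {a b : Fin 6} → toℕ a < toℕ b → toℕ b < 5 → L6-arc a b
  6→1  : L6-arc (fromℕ 5) (Data.Fin.zero)
  6→3  : L6-arc (fromℕ 5) (Data.Fin.suc (Data.Fin.suc Data.Fin.zero))
  6→5  : L6-arc (fromℕ 5) (Data.Fin.suc (Data.Fin.suc (Data.Fin.suc (Data.Fin.suc Data.Fin.zero))))
  2→6  : L6-arc (Data.Fin.suc Data.Fin.zero) (fromℕ 5)
  4→6  : L6-arc (Data.Fin.suc (Data.Fin.suc (Data.Fin.suc Data.Fin.zero))) (fromℕ 5)

-- T[v1..v6] ≅ L6, where v1..v6 are the vertices inject₁ k (k : Fin 6) of a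
-- 7-tournament, and v7 = fromℕ 6. An isomorphism is a bijection
-- f : Fin 6 ↔ Fin 6 (from L6 vertices to {v1..v6}) preserving and reflecting arcs.
FirstSixIsoL6 : Tournament 7 → Set
FirstSixIsoL6 T =
  Σ (Fin 6 ↔ Fin 6) λ f →
    ∀ a b → L6-arc a b ⇔ (_⇒_ T (inject₁ (Inverse.to f a)) (inject₁ (Inverse.to f b)))

Covertices : ∀ {n} → Tournament n → Fin n → Fin n → Set
Covertices T a b =
  ¬ (a ≡ b) × (∀ v → ¬ (v ≡ a) → ¬ (v ≡ b) → (_⇒_ T a v ⇔ _⇒_ T b v))

Revertices : ∀ {n} → Tournament n → Fin n → Fin n → Set
Revertices T a b =
  ¬ (a ≡ b) × (∀ v → ¬ (v ≡ a) → ¬ (v ≡ b) → (_⇒_ T a v ⇔ _⇒_ T v b))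

module Submission where

-- If a and b are each covertices or revertices of a vertex z of a tournament, then on every
-- vertex other than z they behave as covertices (co/co, re/re) or as revertices (co/re), because
-- for w ≠ b the arc w → b is the negation of b → w.  So a copy of L6 avoiding z in which two
-- vertices are twins of z would contain a pair of covertices or revertices; L6 has none.

open import Defs hiding (_⇒_; total; antisym)
open import Data.Bool as Bool using (Bool; true; false)
open import Data.Empty using (⊥-elim)
open import Data.Fin using (Fin; zero; suc; toℕ; inject₁; fromℕ; _≟_)
open import Data.Fin.Properties using (all?; inject₁-injective; fromℕ≢inject₁)
open import Data.Nat using (_<_; _<?_)
open import Data.Product using (_×_; _,_; uncurry)
open import Data.Sum using (_⊎_; inj₁; inj₂; [_,_]′)
open import Function using (_∘_; id)
open import Function.Bundles using (_⇔_; mk⇔; Equivalence; Inverse; Injection)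
open import Function.Properties.Equivalence using (⇔-setoid)
open import Function.Properties.Inverse using (↔⇒↣; ↔-sym)
open import Function.Related.TypeIsomorphisms using (¬-cong-⇔)
open import Level using (0ℓ)
open import Relation.Binary.Definitions using (Decidable)
open import Relation.Binary.PropositionalEquality using (_≡_; _≢_; sym; cong; subst)
import Relation.Binary.Reasoning.Setoid as SetoidReasoning
open import Relation.Nullary using (¬_; Dec)
open import Relation.Nullary.Decidable using (¬?; _×-dec_; _⊎-dec_; _→-dec_; map′; toWitness; T?)

_⇔?_ : ∀ {A B : Set} → Dec A → Dec B → Dec (A ⇔ B)
a? ⇔? b? = map′ (uncurry mk⇔) (λ e → Equivalence.to e , Equivalence.from e) ((a? →-dec b?) ×-dec (b? →-dec a?))

module _ {n} (T : Tournament n) where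
  open Tournament T using (_⇒_; total; antisym)
  open SetoidReasoning (⇔-setoid 0ℓ)

  Twins : Fin n → Fin n → Set
  Twins a b = Covertices T a b ⊎ Revertices T a b

  TwinFree : Set
  TwinFree = ∀ a b → ¬ Twins a b

  AgreeOff OpposeOff : Fin n → Fin n → Fin n → Set
  AgreeOff  z a b = ∀ w → w ≢ a → w ≢ b → w ≢ z → (a ⇒ w) ⇔ (b ⇒ w)
  OpposeOff z a b = ∀ w → w ≢ a → w ≢ b → w ≢ z → (a ⇒ w) ⇔ (w ⇒ b)

  ⇒⇔¬⇐ : ∀ {u v} → u ≢ v → (u ⇒ v) ⇔ (¬ v ⇒ u)
  ⇒⇔¬⇐ {u} {v} u≢v = mk⇔ (antisym u v) (λ v↛u → [ id , ⊥-elim ∘ v↛u ]′ (total u v u≢v))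

  agree-oppose⇒oppose : ∀ {a b z w} → w ≢ b → w ≢ z →
    (a ⇒ w) ⇔ (z ⇒ w) → (b ⇒ w) ⇔ (w ⇒ z) → (a ⇒ w) ⇔ (w ⇒ b)
  agree-oppose⇒oppose {a} {b} {z} {w} w≢b w≢z p q = begin
    a ⇒ w       ≈⟨ p ⟩
    z ⇒ w       ≈⟨ ⇒⇔¬⇐ (w≢z ∘ sym) ⟩
    ¬ (w ⇒ z)   ≈⟨ ¬-cong-⇔ q ⟨
    ¬ (b ⇒ w)   ≈⟨ ⇒⇔¬⇐ w≢b ⟨
    w ⇒ b       ∎

  oppose-agree⇒oppose : ∀ {a b z w} → w ≢ b → w ≢ z →
    (a ⇒ w) ⇔ (w ⇒ z) → (b ⇒ w) ⇔ (z ⇒ w) → (a ⇒ w) ⇔ (w ⇒ b)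
  oppose-agree⇒oppose {a} {b} {z} {w} w≢b w≢z p q = begin
    a ⇒ w       ≈⟨ p ⟩
    w ⇒ z       ≈⟨ ⇒⇔¬⇐ w≢z ⟩
    ¬ (z ⇒ w)   ≈⟨ ¬-cong-⇔ q ⟨
    ¬ (b ⇒ w)   ≈⟨ ⇒⇔¬⇐ w≢b ⟨
    w ⇒ b       ∎

  twins-compose : ∀ {a b z} → Twins a z → Twins b z → AgreeOff z a b ⊎ OpposeOff z a b
  twins-compose (inj₁ (_ , p)) (inj₁ (_ , q)) =
    inj₁ λ w w≢a w≢b w≢z → begin _ ≈⟨ p w w≢a w≢z ⟩ _ ≈⟨ q w w≢b w≢z ⟨ _ ∎
  twins-compose (inj₂ (_ , p)) (inj₂ (_ , q)) =
    inj₁ λ w w≢a w≢b w≢z → begin _ ≈⟨ p w w≢a w≢z ⟩ _ ≈⟨ q w w≢b w≢z ⟨ _ ∎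
  twins-compose (inj₁ (_ , p)) (inj₂ (_ , q)) =
    inj₂ λ w w≢a w≢b w≢z → agree-oppose⇒oppose w≢b w≢z (p w w≢a w≢z) (q w w≢b w≢z)
  twins-compose (inj₂ (_ , p)) (inj₁ (_ , q)) =
    inj₂ λ w w≢a w≢b w≢z → oppose-agree⇒oppose w≢b w≢z (p w w≢a w≢z) (q w w≢b w≢z)

  twins? : Decidable _⇒_ → Decidable Twins
  twins? _⇒?_ a b = covertices? ⊎-dec revertices?
    where
    covertices? : Dec (Covertices T a b)
    covertices? = ¬? (a ≟ b) ×-dec all? λ v →
      ¬? (v ≟ a) →-dec ¬? (v ≟ b) →-dec ((a ⇒? v) ⇔? (b ⇒? v))
    revertices? : Dec (Revertices T a b)
    revertices? = ¬? (a ≟ b) ×-dec all? λ v →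
      ¬? (v ≟ a) →-dec ¬? (v ≟ b) →-dec ((a ⇒? v) ⇔? (v ⇒? b))

module _ {m n} (S : Tournament m) (T : Tournament n)
         (F : Fin m → Fin n) (F-injective : ∀ {a b} → F a ≡ F b → a ≡ b)
         (F-arcs : ∀ a b → Tournament._⇒_ S a b ⇔ Tournament._⇒_ T (F a) (F b))
         (z : Fin n) (z∉F : ∀ a → F a ≢ z) where
  open Tournament S using () renaming (_⇒_ to _⇒ₛ_)
  open Tournament T using () renaming (_⇒_ to _⇒ₜ_)
  open SetoidReasoning (⇔-setoid 0ℓ)

  embedding-reflects-twins : ∀ {a b} → a ≢ b →
    AgreeOff T z (F a) (F b) ⊎ OpposeOff T z (F a) (F b) → Twins S a b
  embedding-reflects-twins {a} {b} a≢b (inj₁ agree) = inj₁ (a≢b , λ c c≢a c≢b → begin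
    a ⇒ₛ c             ≈⟨ F-arcs a c ⟩
    F a ⇒ₜ F c         ≈⟨ agree (F c) (c≢a ∘ F-injective) (c≢b ∘ F-injective) (z∉F c) ⟩
    F b ⇒ₜ F c         ≈⟨ F-arcs b c ⟨
    b ⇒ₛ c             ∎)
  embedding-reflects-twins {a} {b} a≢b (inj₂ oppose) = inj₂ (a≢b , λ c c≢a c≢b → begin
    a ⇒ₛ c             ≈⟨ F-arcs a c ⟩
    F a ⇒ₜ F c         ≈⟨ oppose (F c) (c≢a ∘ F-injective) (c≢b ∘ F-injective) (z∉F c) ⟩
    F c ⇒ₜ F b         ≈⟨ F-arcs c b ⟨
    c ⇒ₛ b             ∎)

  twinFree-embedding-twin-unique : TwinFree S → ∀ {a b} → a ≢ b →
    Twins T (F a) z → ¬ Twins T (F b) z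
  twinFree-embedding-twin-unique free a≢b a~z b~z =
    free _ _ (embedding-reflects-twins a≢b (twins-compose T a~z b~z))

u₆-arc : Fin 6 → Fin 6 → Bool
u₆-arc (suc zero)                          (suc (suc (suc (suc (suc zero))))) = true
u₆-arc (suc (suc (suc zero)))              (suc (suc (suc (suc (suc zero))))) = true
u₆-arc (suc (suc (suc (suc (suc zero))))) zero                                = true
u₆-arc (suc (suc (suc (suc (suc zero))))) (suc (suc zero))                    = true
u₆-arc (suc (suc (suc (suc (suc zero))))) (suc (suc (suc (suc zero))))        = true
u₆-arc _                                   _                                   = false

L6-arc? : Decidable L6-arc
L6-arc? a b = map′ toArc fromArc ((toℕ a <? toℕ b ×-dec toℕ b <? 5) ⊎-dec T? (u₆-arc a b))
  where
  toArc : ∀ {a b} → (toℕ a < toℕ b × toℕ b < 5) ⊎ Bool.T (u₆-arc a b) → L6-arc a b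
  toArc (inj₁ (a<b , b<5)) = low a<b b<5
  toArc {suc zero}                          {suc (suc (suc (suc (suc zero))))} (inj₂ _) = 2→6
  toArc {suc (suc (suc zero))}              {suc (suc (suc (suc (suc zero))))} (inj₂ _) = 4→6
  toArc {suc (suc (suc (suc (suc zero))))} {zero}                             (inj₂ _) = 6→1
  toArc {suc (suc (suc (suc (suc zero))))} {suc (suc zero)}                   (inj₂ _) = 6→3
  toArc {suc (suc (suc (suc (suc zero))))} {suc (suc (suc (suc zero)))}       (inj₂ _) = 6→5
  fromArc : ∀ {a b} → L6-arc a b → (toℕ a < toℕ b × toℕ b < 5) ⊎ Bool.T (u₆-arc a b)
  fromArc (low a<b b<5) = inj₁ (a<b , b<5)
  fromArc 6→1 = inj₂ _
  fromArc 6→3 = inj₂ _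
  fromArc 6→5 = inj₂ _
  fromArc 2→6 = inj₂ _
  fromArc 4→6 = inj₂ _

L6 : Tournament 6
L6 = record
  { _⇒_     = L6-arc
  ; irrefl  = toWitness {a? = all? λ u → ¬? (L6-arc? u u)} _
  ; total   = toWitness {a? = all? λ u → all? λ v → ¬? (u ≟ v) →-dec (L6-arc? u v ⊎-dec L6-arc? v u)} _
  ; antisym = toWitness {a? = all? λ u → all? λ v → L6-arc? u v →-dec ¬? (L6-arc? v u)} _
  }

L6-twinFree : TwinFree L6
L6-twinFree = toWitness {a? = all? λ a → all? λ b → ¬? (twins? L6 L6-arc? a b)} _

corollary3p9 : (T : Tournament 7) → FirstSixIsoL6 T → (i : Fin 6) →
    (Covertices T (inject₁ i) (fromℕ 6) ⊎ Revertices T (inject₁ i) (fromℕ 6)) →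
    (j : Fin 6) → ¬ (j ≡ i) →
      ¬ Covertices T (inject₁ j) (fromℕ 6) × ¬ Revertices T (inject₁ j) (fromℕ 6)
corollary3p9 T (f , iso) i i~v₇ j j≢i = j≁v₇ ∘ inj₁ , j≁v₇ ∘ inj₂
  where
  open Inverse f using (to; from; strictlyInverseˡ)
  F : Fin 6 → Fin 7
  F = inject₁ ∘ to
  F∘from : ∀ k → F (from k) ≡ inject₁ k
  F∘from k = cong inject₁ (strictlyInverseˡ k)
  j≁v₇ : ¬ Twins T (inject₁ j) (fromℕ 6)
  j≁v₇ = subst (λ x → ¬ Twins T x (fromℕ 6)) (F∘from j)
    (twinFree-embedding-twin-unique L6 T F
      (Injection.injective (↔⇒↣ f) ∘ inject₁-injective) iso
      (fromℕ 6) (λ a → fromℕ≢inject₁ ∘ sym)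
      L6-twinFree (j≢i ∘ Injection.injective (↔⇒↣ (↔-sym f)) ∘ sym)
      (subst (λ x → Twins T x (fromℕ 6)) (sym (F∘from i)) i~v₇))
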